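{- Let $G$ be a connected graph with cyclomatic number $k\ge 1$, and let $v_iv_{i+1}$ be an edge lying on a cycle of $G$. Then $H(G)\ge H(G-v_iv_{i+1})-\frac{31}{105}$, where $G-v_iv_{i+1}$ denotes $G$ with the edge $v_iv_{i+1}$ deleted.
   Context: Graphs are finite, simple and undirected. The cyclomatic number of $G$ is $|E(G)|-|V(G)|+1$. For a graph $G$ with vertex degrees $d_i=\deg(v_i)$ (degrees taken in the graph under consideration), the Harmonic index is $H(G)=\sum_{v_iv_j\in E(G)} \frac{2}{d_i+d_j}$, the sum being over all edges. -}

module Defs where

open import Data.Bool using (Bool; true; false; _∧_; not; if_then_else_)
open import Data.Nat using (ℕ; zero; suc; _≤_; _<_; _≟_)
open import Data.Fin using (Fin; toℕ)
open import Data.Fin.Properties using () renaming (_≟_ to _≟ᶠ_)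
open import Data.List using (List; []; _∷_; length; filter; allFin; map; sum; foldr; concatMap)
open import Data.List.Relation.Unary.Unique.Propositional using (Unique)
open import Data.Integer using (+_)
open import Data.Rational using (ℚ; 0ℚ; _/_) renaming (_+_ to _+ℚ_)
open import Data.Product using (Σ; _×_; ∃)
open import Relation.Binary.PropositionalEquality using (_≡_)
open import Relation.Nullary.Decidable using (⌊_⌋)

record Graph (n : ℕ) : Set where
  field
    adj   : Fin n → Fin n → Bool
    sym   : ∀ i j → adj i j ≡ adj j i
    irrefl : ∀ i → adj i i ≡ false
open Graph public

deg : ∀ {n} → Graph n → Fin n → ℕ
deg G i = length (filter (λ j → adj G i j ≡? true) (allFin _))
  where
  open import Data.Bool.Properties using () renaming (_≟_ to _≡?_)

Edge : ℕ → Set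
Edge n = Fin n × Fin n

edges : ∀ {n} → Graph n → List (Edge n)
edges {n} G = concatMap (λ i → map (λ j → (i Data.Product., j))
                 (filter (λ j → toℕ i <? toℕ j) (filter (λ j → adj G i j ≡? true) (allFin n))))
               (allFin n)
  where
  open import Data.Bool.Properties using () renaming (_≟_ to _≡?_)
  open import Data.Nat using (_<?_)

∣E∣ : ∀ {n} → Graph n → ℕ
∣E∣ G = length (edges G)

-- 2/m as a rational; only used with m = d_i + d_j ≥ 2 for an edge v_i v_j
two/ : ℕ → ℚ
two/ zero    = 0ℚ
two/ (suc m) = + 2 / suc m

H : ∀ {n} → Graph n → ℚ
H G = foldr (λ e acc → two/ (deg G (Data.Product.proj₁ e) Data.Nat.+ deg G (Data.Product.proj₂ e)) +ℚ acc) 0ℚ (edges G)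

data Walk {n} (G : Graph n) : Fin n → Fin n → List (Fin n) → Set where
  here : ∀ {u} → Walk G u u (u ∷ [])
  step : ∀ {u w v ws} → adj G u w ≡ true → Walk G w v ws → Walk G u v (u ∷ ws)

Connected : ∀ {n} → Graph n → Set
Connected {n} G = ∀ (u v : Fin n) → ∃ λ ws → Walk G u v ws

-- cyclomatic number |E| - |V| + 1 ≥ 1, stated without truncated subtraction
CyclomaticAtLeast1 : ∀ {n} → Graph n → Set
CyclomaticAtLeast1 {n} G = n Data.Nat.+ 1 ≤ ∣E∣ G Data.Nat.+ 1

-- The edge uv lies on a cycle of G: there is a path u = w₀, w₁, …, w_m = v
-- with pairwise distinct vertices and at least 3 vertices, which together with
-- the edge vu closes up to a cycle containing uv.
OnCycle : ∀ {n} → Graph n → Fin n → Fin n → Set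
OnCycle G u v = adj G u v ≡ true ×
  ∃ λ ws → Walk G u v ws × Unique ws × 3 ≤ length ws

deleteEdge : ∀ {n} → Graph n → Fin n → Fin n → Graph n
deleteEdge {n} G u v = record
  { adj = adj'
  ; sym = symm
  ; irrefl = irr
  }
  where
  isUV : Fin n → Fin n → Bool
  isUV i j = (⌊ i ≟ᶠ u ⌋ ∧ ⌊ j ≟ᶠ v ⌋) Data.Bool.∨ (⌊ i ≟ᶠ v ⌋ ∧ ⌊ j ≟ᶠ u ⌋)
  adj' : Fin n → Fin n → Bool
  adj' i j = adj G i j ∧ not (isUV i j)
  open import Relation.Binary.PropositionalEquality using (cong₂; refl)
  open import Data.Bool.Properties using (∧-comm; ∨-comm)
  open import Relation.Binary.PropositionalEquality using (trans)
  isUV-sym : ∀ i j → isUV i j ≡ isUV j i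
  isUV-sym i j = trans
    (∨-comm (⌊ i ≟ᶠ u ⌋ ∧ ⌊ j ≟ᶠ v ⌋) (⌊ i ≟ᶠ v ⌋ ∧ ⌊ j ≟ᶠ u ⌋))
    (cong₂ Data.Bool._∨_ (∧-comm (⌊ i ≟ᶠ v ⌋) (⌊ j ≟ᶠ u ⌋)) (∧-comm (⌊ i ≟ᶠ u ⌋) (⌊ j ≟ᶠ v ⌋)))
  symm : ∀ i j → adj' i j ≡ adj' j i
  symm i j = cong₂ (λ a b → a ∧ not b) (sym G i j) (isUV-sym i j)
  irr : ∀ i → adj' i i ≡ false
  irr i rewrite irrefl G i = refl

-- Deleting uv lowers the degrees of u and v by one and changes only the weights of edges at u
-- or v. The edge uv itself takes c = 2/(d_u + d_v) away. An edge uj with d_j ≥ 1 gains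
-- 2/(d_u − 1 + d_j) − 2/(d_u + d_j) = δ (d_u − 1 + d_j) ≤ δ d_u, where δ m = 2/(m(m+1)); for the
-- neighbour w of u on the cycle d_w ≥ 2, so its gain is at most δ (d_u + 1). Writing d_u = k + 2
-- (neighbours v, w and k others), the total gain at u is at most Φ k = k δ (k+2) + δ (k+3), and
-- likewise at v with d_v = l + 2. Hence H (G − uv) − H G ≤ Φ k + Φ l − 2/(k + l + 4), whose
-- maximum over k, l is 31/105, attained at k = l = 3.

module Submission where

open import Data.Bool using (Bool; true; false; if_then_else_; _∧_; not)
open import Data.Bool.Properties using (∧-identityʳ; ∧-zeroʳ; ∨-identityʳ)
import Data.Bool.Properties as BoolP
open import Data.Empty using (⊥-elim)
open import Data.Fin using (Fin; zero; suc; toℕ; punchIn)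
open import Data.Fin.Properties using (_≟_; toℕ-injective; punchInᵢ≢i)
open import Data.Integer as ℤ using (+_)
import Data.Integer.Properties as ℤP
open import Data.List using (List; []; _∷_; _++_; map; filter; tabulate; concatMap; length; foldr; allFin)
import Data.List.Properties as ListP
open import Data.List.Membership.Propositional using (_∈_)
open import Data.List.Relation.Unary.Any using (here; there)
open import Data.List.Relation.Unary.All as All using (All)
open import Data.List.Relation.Unary.AllPairs using (_∷_)
open import Data.List.Relation.Unary.Unique.Propositional using (Unique)
open import Data.Nat as ℕ using (ℕ; zero; suc; z≤n; s≤s; _<_; _<?_; _<ᵇ_; NonZero)
import Data.Nat.Properties as ℕP
open import Data.Nat.Tactic.RingSolver using (solve-∀)
open import Data.Product using (_×_; _,_; proj₁; proj₂; ∃-syntax)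
open import Data.Rational as ℚ using (ℚ; 0ℚ; _/_; toℚᵘ)
import Data.Rational.Properties as ℚP
open import Data.Rational.Solver using (module +-*-Solver)
open import Data.Rational.Unnormalised as ℚᵘ using (mkℚᵘ; *≤*)
import Data.Rational.Unnormalised.Properties as ℚᵘP
open import Data.Sum using (_⊎_; inj₁; inj₂)
open import Function using (_∘_)
open import Relation.Binary.PropositionalEquality
open import Relation.Nullary.Decidable using (Dec; yes; no; does; ⌊_⌋; toWitness)
open import Relation.Nullary.Reflects using (ofʸ; ofⁿ)
open import Relation.Unary using (Decidable)
open import Algebra.Properties.Monoid.Mult ℚP.+-0-monoid using () renaming (_×_ to _·_)
import Algebra.Properties.CommutativeMonoid.Sum ℕP.+-0-commutativeMonoid as Σℕ
open import Algebra.Properties.CommutativeMonoid.Sum ℚP.+-0-commutativeMonoid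
  using (sum; ∑-distrib-+; ∑-comm; sum-cong-≗; sum-remove; sum-replicate-zero)
open import Defs hiding (sym)

private
  variable
    n : ℕ
    A B : Set

toℚᵘ-/ : ∀ p q → toℚᵘ (+ p / suc q) ℚᵘ.≃ mkℚᵘ (+ p) q
toℚᵘ-/ p q = ℚP.toℚᵘ-fromℚᵘ (mkℚᵘ (+ p) q)

fraction-≤ : ∀ p q r s .{{_ : NonZero q}} .{{_ : NonZero s}} →
             p ℕ.* s ℕ.≤ r ℕ.* q → + p / q ℚ.≤ + r / s
fraction-≤ p (suc q) r (suc s) ps≤rq = ℚP.toℚᵘ-cancel-≤
  (ℚᵘP.≤-respˡ-≃ (ℚᵘP.≃-sym (toℚᵘ-/ p q)) (ℚᵘP.≤-respʳ-≃ (ℚᵘP.≃-sym (toℚᵘ-/ r s)) (*≤* ps≤rq′)))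
  where
  ps≤rq′ : + p ℤ.* + suc s ℤ.≤ + r ℤ.* + suc q
  ps≤rq′ = subst₂ ℤ._≤_ (ℤP.pos-* p (suc s)) (ℤP.pos-* r (suc q)) (ℤ.+≤+ ps≤rq)

fraction-≡ : ∀ p q r s .{{_ : NonZero q}} .{{_ : NonZero s}} →
             p ℕ.* s ≡ r ℕ.* q → + p / q ≡ + r / s
fraction-≡ p q r s eq =
  ℚP.≤-antisym (fraction-≤ p q r s (ℕP.≤-reflexive eq)) (fraction-≤ r s p q (ℕP.≤-reflexive (sym eq)))

fraction-+ : ∀ p q r s .{{_ : NonZero q}} .{{_ : NonZero s}} →
             + p / q ℚ.+ + r / s ≡ (+ (p ℕ.* s ℕ.+ r ℕ.* q) / (q ℕ.* s)) {{ℕP.m*n≢0 q s}}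
fraction-+ p (suc q) r (suc s) = ℚP.toℚᵘ-injective (begin
  toℚᵘ (+ p / suc q ℚ.+ + r / suc s)          ≈⟨ ℚP.toℚᵘ-homo-+ (+ p / suc q) (+ r / suc s) ⟩
  toℚᵘ (+ p / suc q) ℚᵘ.+ toℚᵘ (+ r / suc s)  ≈⟨ ℚᵘP.+-cong (toℚᵘ-/ p q) (toℚᵘ-/ r s) ⟩
  mkℚᵘ (+ p) q ℚᵘ.+ mkℚᵘ (+ r) s              ≡⟨ cong (λ x → mkℚᵘ x (s ℕ.+ q ℕ.* suc s)) numerator ⟩
  mkℚᵘ (+ (p ℕ.* suc s ℕ.+ r ℕ.* suc q)) (s ℕ.+ q ℕ.* suc s) ≈⟨ ℚᵘP.≃-sym (toℚᵘ-/ _ _) ⟩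
  toℚᵘ (+ (p ℕ.* suc s ℕ.+ r ℕ.* suc q) / (suc q ℕ.* suc s)) ∎)
  where
  open ℚᵘP.≃-Reasoning
  numerator : + p ℤ.* + suc s ℤ.+ + r ℤ.* + suc q ≡ + (p ℕ.* suc s ℕ.+ r ℕ.* suc q)
  numerator = sym (trans (ℤP.pos-+ (p ℕ.* suc s) (r ℕ.* suc q))
                         (cong₂ ℤ._+_ (ℤP.pos-* p (suc s)) (ℤP.pos-* r (suc q))))

p≤p+q : ∀ {p q} → 0ℚ ℚ.≤ q → p ℚ.≤ p ℚ.+ q
p≤p+q {p} {q} 0≤q = subst (ℚ._≤ p ℚ.+ q) (ℚP.+-identityʳ p) (ℚP.+-monoʳ-≤ p 0≤q)

p+r≤q+[s+r]⇒p-s≤q : ∀ {p q r s} → p ℚ.+ r ℚ.≤ q ℚ.+ (s ℚ.+ r) → p ℚ.- s ℚ.≤ q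
p+r≤q+[s+r]⇒p-s≤q {p} {q} {r} {s} ineq = subst₂ ℚ._≤_ (left p r s) (right q r s) (ℚP.+-monoˡ-≤ (ℚ.- (s ℚ.+ r)) ineq)
  where
  open +-*-Solver
  left : ∀ p r s → p ℚ.+ r ℚ.- (s ℚ.+ r) ≡ p ℚ.- s
  left = solve 3 (λ p r s → p :+ r :- (s :+ r) := p :- s) refl
  right : ∀ q r s → q ℚ.+ (s ℚ.+ r) ℚ.- (s ℚ.+ r) ≡ q
  right = solve 3 (λ q r s → q :+ (s :+ r) :- (s :+ r) := q) refl

-- The gain δ and the endpoint bound Φ

δ : ℕ → ℚ
δ zero    = 0ℚ
δ (suc m) = + 2 / (suc m ℕ.* suc (suc m))

two/-split : ∀ m → two/ (suc m) ≡ two/ (suc (suc m)) ℚ.+ δ (suc m)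
two/-split m = begin
  + 2 / suc m                                              ≡⟨ fraction-≡ 2 (suc m) (2 ℕ.* d ℕ.+ 2 ℕ.* suc (suc m)) (suc (suc m) ℕ.* d) (cross m) ⟩
  + (2 ℕ.* d ℕ.+ 2 ℕ.* suc (suc m)) / (suc (suc m) ℕ.* d) ≡⟨ fraction-+ 2 (suc (suc m)) 2 d ⟨
  + 2 / suc (suc m) ℚ.+ + 2 / d                            ∎
  where
  open ≡-Reasoning
  d = suc m ℕ.* suc (suc m)
  cross : ∀ m → 2 ℕ.* (suc (suc m) ℕ.* (suc m ℕ.* suc (suc m)))
              ≡ (2 ℕ.* (suc m ℕ.* suc (suc m)) ℕ.+ 2 ℕ.* suc (suc m)) ℕ.* suc m
  cross = solve-∀

δ-antitone : ∀ {a b} → a ℕ.≤ b → δ (suc b) ℚ.≤ δ (suc a)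
δ-antitone {a} {b} a≤b = fraction-≤ 2 (suc b ℕ.* suc (suc b)) 2 (suc a ℕ.* suc (suc a))
  (ℕP.*-monoʳ-≤ 2 (ℕP.*-mono-≤ (s≤s a≤b) (s≤s (s≤s a≤b))))

δ-nonneg : ∀ m → 0ℚ ℚ.≤ δ m
δ-nonneg zero    = ℚP.≤-refl
δ-nonneg (suc m) = fraction-≤ 0 1 2 (suc m ℕ.* suc (suc m)) z≤n

two/-nonneg : ∀ m → 0ℚ ℚ.≤ two/ m
two/-nonneg zero    = ℚP.≤-refl
two/-nonneg (suc m) = fraction-≤ 0 1 2 (suc m) z≤n

two/-step : ∀ a x y → suc y ℕ.≤ x → two/ (a ℕ.+ x) ℚ.≤ two/ (suc a ℕ.+ x) ℚ.+ δ (suc y ℕ.+ a)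
two/-step a (suc x) y (s≤s y≤x) = begin
  two/ (a ℕ.+ suc x)                                ≡⟨ cong two/ (ℕP.+-suc a x) ⟩
  two/ (suc m)                                      ≡⟨ two/-split m ⟩
  two/ (suc (suc m)) ℚ.+ δ (suc m)                  ≤⟨ ℚP.+-monoʳ-≤ (two/ (suc (suc m))) (δ-antitone y+a≤m) ⟩
  two/ (suc (suc m)) ℚ.+ δ (suc (y ℕ.+ a))          ≡⟨ cong (λ k → two/ (suc k) ℚ.+ δ (suc y ℕ.+ a)) (ℕP.+-suc a x) ⟨
  two/ (suc a ℕ.+ suc x) ℚ.+ δ (suc y ℕ.+ a)        ∎
  where
  open ℚP.≤-Reasoning
  m = a ℕ.+ x
  y+a≤m : y ℕ.+ a ℕ.≤ m
  y+a≤m = ℕP.≤-trans (ℕP.≤-reflexive (ℕP.+-comm y a)) (ℕP.+-monoʳ-≤ a y≤x)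

·-fraction : ∀ k p q .{{_ : NonZero q}} → k · (+ p / q) ≡ + (k ℕ.* p) / q
·-fraction zero    p q = sym (ℚP.0/n≡0 q)
·-fraction (suc k) p q = begin
  + p / q ℚ.+ k · (+ p / q)       ≡⟨ cong (+ p / q ℚ.+_) (·-fraction k p q) ⟩
  + p / q ℚ.+ + (k ℕ.* p) / q     ≡⟨ fraction-+ p q (k ℕ.* p) q ⟩
  (+ (p ℕ.* q ℕ.+ k ℕ.* p ℕ.* q) / (q ℕ.* q)) {{ℕP.m*n≢0 q q}}
    ≡⟨ fraction-≡ (p ℕ.* q ℕ.+ k ℕ.* p ℕ.* q) (q ℕ.* q) (suc k ℕ.* p) q {{ℕP.m*n≢0 q q}} (cross p q k) ⟩
  + (suc k ℕ.* p) / q             ∎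
  where
  open ≡-Reasoning
  cross : ∀ p q k → (p ℕ.* q ℕ.+ k ℕ.* p ℕ.* q) ℕ.* q ≡ (suc k ℕ.* p) ℕ.* (q ℕ.* q)
  cross = solve-∀

Φ : ℕ → ℚ
Φ k = k · δ (2 ℕ.+ k) ℚ.+ δ (3 ℕ.+ k)

Φ≤two/ : ∀ k → Φ k ℚ.≤ two/ (3 ℕ.+ k)
Φ≤two/ k = begin
  k · δ (2 ℕ.+ k) ℚ.+ δ (3 ℕ.+ k)             ≤⟨ ℚP.+-monoʳ-≤ (k · δ (2 ℕ.+ k)) (δ-antitone (ℕP.n≤1+n (suc k))) ⟩
  k · δ (2 ℕ.+ k) ℚ.+ δ (2 ℕ.+ k)             ≡⟨ ℚP.+-comm (k · δ (2 ℕ.+ k)) (δ (2 ℕ.+ k)) ⟩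
  suc k · δ (2 ℕ.+ k)                         ≡⟨ ·-fraction (suc k) 2 d ⟩
  + (suc k ℕ.* 2) / d                         ≤⟨ fraction-≤ (suc k ℕ.* 2) d 2 (3 ℕ.+ k) cross ⟩
  two/ (3 ℕ.+ k)                              ∎
  where
  open ℚP.≤-Reasoning
  d = (2 ℕ.+ k) ℕ.* (3 ℕ.+ k)
  cross : suc k ℕ.* 2 ℕ.* (3 ℕ.+ k) ℕ.≤ 2 ℕ.* d
  cross = ℕP.≤-trans (ℕP.≤-reflexive (left k)) (ℕP.≤-trans (ℕP.*-monoʳ-≤ (2 ℕ.* (3 ℕ.+ k)) (ℕP.n≤1+n (suc k)))
                     (ℕP.≤-reflexive (right k)))
    where
    left : ∀ k → suc k ℕ.* 2 ℕ.* (3 ℕ.+ k) ≡ 2 ℕ.* (3 ℕ.+ k) ℕ.* suc k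
    left = solve-∀
    right : ∀ k → 2 ℕ.* (3 ℕ.+ k) ℕ.* (2 ℕ.+ k) ≡ 2 ℕ.* ((2 ℕ.+ k) ℕ.* (3 ℕ.+ k))
    right = solve-∀

Φ≤2/70 : ∀ {k} → 67 ℕ.≤ k → Φ k ℚ.≤ + 2 / 70
Φ≤2/70 {k} 67≤k = ℚP.≤-trans (Φ≤two/ k) (fraction-≤ 2 (3 ℕ.+ k) 2 70 (ℕP.*-monoʳ-≤ 2 (s≤s (s≤s (s≤s 67≤k)))))

Φ≤4/15 : ∀ k → Φ k ℚ.≤ + 4 / 15
Φ≤4/15 k with k ℕ.<? 67
... | yes k<67 = Φ-box k<67
  where
  Φ-box : ∀ {i} → i < 67 → Φ i ℚ.≤ + 4 / 15
  Φ-box = toWitness {a? = ℕP.allUpTo? (λ i → Φ i ℚP.≤? + 4 / 15) 67} _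
... | no  k≮67 = ℚP.≤-trans (Φ≤2/70 (ℕP.≮⇒≥ k≮67)) (fraction-≤ 2 70 4 15 (ℕP.≤ᵇ⇒≤ (2 ℕ.* 15) (4 ℕ.* 70) _))

-- Outside the square k, l < 67 one of Φ k, Φ l is at most 2/70, and 4/15 + 2/70 = 31/105;
-- inside it the bound is checked by evaluation.
Φ-pair-box : ∀ {k} → k < 67 → ∀ {l} → l < 67 →
             Φ k ℚ.+ Φ l ℚ.≤ + 31 / 105 ℚ.+ two/ ((2 ℕ.+ k) ℕ.+ (2 ℕ.+ l))
Φ-pair-box = toWitness {a? = ℕP.allUpTo? (λ k → ℕP.allUpTo? (λ l →
  Φ k ℚ.+ Φ l ℚP.≤? + 31 / 105 ℚ.+ two/ ((2 ℕ.+ k) ℕ.+ (2 ℕ.+ l))) 67) 67} _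

Φ-pair-tail : ∀ k l m → 67 ℕ.≤ l → Φ k ℚ.+ Φ l ℚ.≤ + 31 / 105 ℚ.+ two/ m
Φ-pair-tail k l m 67≤l = begin
  Φ k ℚ.+ Φ l          ≤⟨ ℚP.+-mono-≤ (Φ≤4/15 k) (Φ≤2/70 67≤l) ⟩
  + 4 / 15 ℚ.+ + 2 / 70 ≡⟨⟩
  + 31 / 105           ≤⟨ p≤p+q (two/-nonneg m) ⟩
  + 31 / 105 ℚ.+ two/ m ∎
  where open ℚP.≤-Reasoning

Φ-pair : ∀ k l → Φ k ℚ.+ Φ l ℚ.≤ + 31 / 105 ℚ.+ two/ ((2 ℕ.+ k) ℕ.+ (2 ℕ.+ l))
Φ-pair k l = byRegion (k ℕ.<? 67) (l ℕ.<? 67)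
  where
  m = (2 ℕ.+ k) ℕ.+ (2 ℕ.+ l)
  byRegion : Dec (k < 67) → Dec (l < 67) → Φ k ℚ.+ Φ l ℚ.≤ + 31 / 105 ℚ.+ two/ m
  byRegion (yes k<67) (yes l<67) = Φ-pair-box k<67 l<67
  byRegion _          (no  l≮67) = Φ-pair-tail k l m (ℕP.≮⇒≥ l≮67)
  byRegion (no  k≮67) _          =
    subst (ℚ._≤ + 31 / 105 ℚ.+ two/ m) (ℚP.+-comm (Φ l) (Φ k)) (Φ-pair-tail l k m (ℕP.≮⇒≥ k≮67))

indicator : Bool → ℕ
indicator b = if b then 1 else 0

count : (Fin n → Bool) → ℕ
count p = Σℕ.sum (λ j → indicator (p j))

remove : Fin n → (Fin n → Bool) → Fin n → Bool
remove a p j = p j ∧ not ⌊ j ≟ a ⌋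

⌊≟⌋-refl : ∀ (i : Fin n) → ⌊ i ≟ i ⌋ ≡ true
⌊≟⌋-refl i = cong ⌊_⌋ (≡-≟-identity _≟_ refl)

⌊≟⌋-≢ : ∀ {i j : Fin n} → i ≢ j → ⌊ i ≟ j ⌋ ≡ false
⌊≟⌋-≢ i≢j = cong ⌊_⌋ (≢-≟-identity _≟_ i≢j)

remove-self : ∀ a (p : Fin n → Bool) → remove a p a ≡ false
remove-self a p = trans (cong (λ b → p a ∧ not b) (⌊≟⌋-refl a)) (∧-zeroʳ (p a))

remove-other : ∀ {a j} (p : Fin n → Bool) → j ≢ a → remove a p j ≡ p j
remove-other {j = j} p j≢a = trans (cong (λ b → p j ∧ not b) (⌊≟⌋-≢ j≢a)) (∧-identityʳ (p j))

count-remove : ∀ (p : Fin n → Bool) a → p a ≡ true → count p ≡ suc (count (remove a p))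
count-remove {suc n} p a pa = begin
  count p                                       ≡⟨ Σℕ.sum-remove {i = a} (indicator ∘ p) ⟩
  indicator (p a) ℕ.+ rest p                    ≡⟨ cong₂ ℕ._+_ (cong indicator pa) (Σℕ.sum-cong-≗ unchanged) ⟩
  suc (rest (remove a p))                       ≡⟨ cong (λ b → suc (indicator b ℕ.+ rest (remove a p))) (remove-self a p) ⟨
  suc (indicator (remove a p a) ℕ.+ rest (remove a p)) ≡⟨ cong suc (Σℕ.sum-remove {i = a} (indicator ∘ remove a p)) ⟨
  suc (count (remove a p))                      ∎
  where
  open ≡-Reasoning
  rest : (Fin (suc n) → Bool) → ℕ
  rest q = Σℕ.sum (indicator ∘ q ∘ punchIn a)
  unchanged : ∀ j → indicator (p (punchIn a j)) ≡ indicator (remove a p (punchIn a j))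
  unchanged j = cong indicator (sym (remove-other p (punchInᵢ≢i a j)))

sum-mono-≤ : ∀ {f g : Fin n → ℚ} → (∀ i → f i ℚ.≤ g i) → sum f ℚ.≤ sum g
sum-mono-≤ {zero}  f≤g = ℚP.≤-refl
sum-mono-≤ {suc n} f≤g = ℚP.+-mono-≤ (f≤g zero) (sum-mono-≤ (f≤g ∘ suc))

sum-zero : ∀ {f : Fin n → ℚ} → (∀ i → f i ≡ 0ℚ) → sum f ≡ 0ℚ
sum-zero {n} f≗0 = trans (sum-cong-≗ f≗0) (sum-replicate-zero n)

sum-single : ∀ (f : Fin n → ℚ) a → (∀ i → i ≢ a → f i ≡ 0ℚ) → sum f ≡ f a
sum-single {suc n} f a f≗0 = begin
  sum f                        ≡⟨ sum-remove {i = a} f ⟩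
  f a ℚ.+ sum (f ∘ punchIn a)  ≡⟨ cong (f a ℚ.+_) (sum-zero (λ j → f≗0 (punchIn a j) (punchInᵢ≢i a j))) ⟩
  f a ℚ.+ 0ℚ                   ≡⟨ ℚP.+-identityʳ (f a) ⟩
  f a                          ∎
  where open ≡-Reasoning

sum-indicator : ∀ (p : Fin n → Bool) x → sum (λ j → if p j then x else 0ℚ) ≡ count p · x
sum-indicator {zero}  p x = refl
sum-indicator {suc n} p x with p zero
... | true  = cong (x ℚ.+_) (sum-indicator (p ∘ suc) x)
... | false = trans (ℚP.+-identityˡ _) (sum-indicator (p ∘ suc) x)

∑∑ : (Fin n → Fin n → ℚ) → ℚ
∑∑ R = sum (λ i → sum (R i))

∑∑-+ : ∀ (R S : Fin n → Fin n → ℚ) → ∑∑ (λ i j → R i j ℚ.+ S i j) ≡ ∑∑ R ℚ.+ ∑∑ S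
∑∑-+ R S = trans (sum-cong-≗ (λ i → ∑-distrib-+ (R i) (S i))) (∑-distrib-+ (λ i → sum (R i)) (λ i → sum (S i)))

row : Fin n → (Fin n → ℚ) → Fin n → Fin n → ℚ
row a f i j = if ⌊ i ≟ a ⌋ then f j else 0ℚ

∑∑-row : ∀ a (f : Fin n → ℚ) → ∑∑ (row a f) ≡ sum f
∑∑-row a f = trans (sum-single (λ i → sum (row a f i)) a other-rows)
                   (cong (λ b → sum (λ j → if b then f j else 0ℚ)) (⌊≟⌋-refl a))
  where
  other-rows : ∀ i → i ≢ a → sum (row a f i) ≡ 0ℚ
  other-rows i i≢a = sum-zero (λ j → cong (λ b → if b then f j else 0ℚ) (⌊≟⌋-≢ i≢a))

upper : (Fin n → Fin n → ℚ) → Fin n → Fin n → ℚ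
upper R i j = if toℕ i <ᵇ toℕ j then R i j else 0ℚ

∑< : (Fin n → Fin n → ℚ) → ℚ
∑< R = ∑∑ (upper R)

upper-+ : ∀ (R S : Fin n → Fin n → ℚ) i j → upper (λ i j → R i j ℚ.+ S i j) i j ≡ upper R i j ℚ.+ upper S i j
upper-+ R S i j with toℕ i <ᵇ toℕ j
... | true  = refl
... | false = sym (ℚP.+-identityˡ 0ℚ)

∑<-+ : ∀ (R S : Fin n → Fin n → ℚ) → ∑< (λ i j → R i j ℚ.+ S i j) ≡ ∑< R ℚ.+ ∑< S
∑<-+ R S = trans (sum-cong-≗ (λ i → sum-cong-≗ (upper-+ R S i))) (∑∑-+ (upper R) (upper S))

∑<-mono-≤ : ∀ {R S : Fin n → Fin n → ℚ} → (∀ i j → i ≢ j → R i j ℚ.≤ S i j) → ∑< R ℚ.≤ ∑< S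
∑<-mono-≤ {R = R} {S} R≤S = sum-mono-≤ (λ i → sum-mono-≤ (λ j → upper-mono i j))
  where
  upper-mono : ∀ i j → upper R i j ℚ.≤ upper S i j
  upper-mono i j with toℕ i <ᵇ toℕ j | ℕP.<ᵇ-reflects-< (toℕ i) (toℕ j)
  ... | true  | ofʸ i<j = R≤S i j (λ { refl → ℕP.<-irrefl refl i<j })
  ... | false | _       = ℚP.≤-refl

∑<-symmetrise : ∀ (R : Fin n → Fin n → ℚ) → (∀ i → R i i ≡ 0ℚ) → ∑< (λ i j → R i j ℚ.+ R j i) ≡ ∑∑ R
∑<-symmetrise R R-diag = begin
  ∑< (λ i j → R i j ℚ.+ R j i)       ≡⟨ ∑<-+ R (λ i j → R j i) ⟩
  ∑< R ℚ.+ ∑< (λ i j → R j i)        ≡⟨ cong (∑< R ℚ.+_) (∑-comm (λ i j → upper (λ i j → R j i) i j)) ⟩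
  ∑∑ (upper R) ℚ.+ ∑∑ lower          ≡⟨ ∑∑-+ (upper R) lower ⟨
  ∑∑ (λ i j → upper R i j ℚ.+ lower i j) ≡⟨ sum-cong-≗ (λ i → sum-cong-≗ (upper+lower i)) ⟩
  ∑∑ R                               ∎
  where
  open ≡-Reasoning
  lower : Fin _ → Fin _ → ℚ
  lower i j = if toℕ j <ᵇ toℕ i then R i j else 0ℚ
  upper+lower : ∀ i j → upper R i j ℚ.+ lower i j ≡ R i j
  upper+lower i j with toℕ i <ᵇ toℕ j | ℕP.<ᵇ-reflects-< (toℕ i) (toℕ j)
                     | toℕ j <ᵇ toℕ i | ℕP.<ᵇ-reflects-< (toℕ j) (toℕ i)
  ... | true  | ofʸ i<j | true  | ofʸ j<i = ⊥-elim (ℕP.<-asym i<j j<i)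
  ... | true  | _       | false | _       = ℚP.+-identityʳ (R i j)
  ... | false | _       | true  | _       = ℚP.+-identityˡ (R i j)
  ... | false | ofⁿ i≮j | false | ofⁿ j≮i with toℕ-injective (ℕP.≤-antisym (ℕP.≮⇒≥ j≮i) (ℕP.≮⇒≥ i≮j))
  ...   | refl = trans (ℚP.+-identityˡ 0ℚ) (sym (R-diag i))

row-self : ∀ a (f : Fin n → ℚ) j → row a f a j ≡ f j
row-self a f j = cong (λ b → if b then f j else 0ℚ) (⌊≟⌋-refl a)

row-other : ∀ {a i} (f : Fin n → ℚ) → i ≢ a → ∀ j → row a f i j ≡ 0ℚ
row-other f i≢a j = cong (λ b → if b then f j else 0ℚ) (⌊≟⌋-≢ i≢a)

row-nonneg : ∀ a (f : Fin n → ℚ) → (∀ j → 0ℚ ℚ.≤ f j) → ∀ i j → 0ℚ ℚ.≤ row a f i j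
row-nonneg a f 0≤f i j with ⌊ i ≟ a ⌋
... | true  = 0≤f j
... | false = ℚP.≤-refl

row-diag : ∀ a (f : Fin n → ℚ) → f a ≡ 0ℚ → ∀ i → row a f i i ≡ 0ℚ
row-diag a f fa≡0 i = byCases (i ≟ a)
  where
  byCases : Dec (i ≡ a) → row a f i i ≡ 0ℚ
  byCases (yes refl) = trans (row-self a f a) fa≡0
  byCases (no  i≢a)  = row-other f i≢a i

-- The harmonic index as a sum over pairs

sumOver : (A → ℚ) → List A → ℚ
sumOver t = foldr (λ x s → t x ℚ.+ s) 0ℚ

sumOver-++ : ∀ (t : A → ℚ) xs ys → sumOver t (xs ++ ys) ≡ sumOver t xs ℚ.+ sumOver t ys
sumOver-++ t []       ys = sym (ℚP.+-identityˡ _)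
sumOver-++ t (x ∷ xs) ys = trans (cong (t x ℚ.+_) (sumOver-++ t xs ys)) (sym (ℚP.+-assoc (t x) _ _))

sumOver-concatMap : ∀ (t : B → ℚ) (f : A → List B) xs →
                    sumOver t (concatMap f xs) ≡ sumOver (sumOver t ∘ f) xs
sumOver-concatMap t f []       = refl
sumOver-concatMap t f (x ∷ xs) =
  trans (sumOver-++ t (f x) (concatMap f xs)) (cong (sumOver t (f x) ℚ.+_) (sumOver-concatMap t f xs))

sumOver-map : ∀ (t : B → ℚ) (f : A → B) xs → sumOver t (map f xs) ≡ sumOver (t ∘ f) xs
sumOver-map t f = ListP.foldr-map _ f 0ℚ

sumOver-filter : ∀ {P : A → Set} (P? : Decidable P) (t : A → ℚ) xs →
                 sumOver t (filter P? xs) ≡ sumOver (λ x → if does (P? x) then t x else 0ℚ) xs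
sumOver-filter P? t []       = refl
sumOver-filter P? t (x ∷ xs) with does (P? x)
... | true  = cong (t x ℚ.+_) (sumOver-filter P? t xs)
... | false = trans (sumOver-filter P? t xs) (sym (ℚP.+-identityˡ _))

sumOver-tabulate : ∀ (t : A → ℚ) (f : Fin n → A) → sumOver t (tabulate f) ≡ sum (t ∘ f)
sumOver-tabulate {n = zero}  t f = refl
sumOver-tabulate {n = suc n} t f = cong (t (f zero) ℚ.+_) (sumOver-tabulate t (f ∘ suc))

length-filter-tabulate : ∀ {P : A → Set} (P? : Decidable P) (f : Fin n → A) →
                         length (filter P? (tabulate f)) ≡ Σℕ.sum (λ i → indicator (does (P? (f i))))
length-filter-tabulate {n = zero}  P? f = refl
length-filter-tabulate {n = suc n} P? f with does (P? (f zero))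
... | true  = cong suc (length-filter-tabulate P? (f ∘ suc))
... | false = length-filter-tabulate P? (f ∘ suc)

does-≟-true : ∀ b → does (b BoolP.≟ true) ≡ b
does-≟-true true  = refl
does-≟-true false = refl

deg-count : ∀ (K : Graph n) i → deg K i ≡ count (adj K i)
deg-count K i = trans (length-filter-tabulate (λ j → adj K i j BoolP.≟ true) (λ j → j))
                      (Σℕ.sum-cong-≗ (λ j → cong indicator (does-≟-true (adj K i j))))

weight : Graph n → Fin n → Fin n → ℚ
weight K i j = if adj K i j then two/ (deg K i ℕ.+ deg K j) else 0ℚ

weight-sym : ∀ (K : Graph n) i j → weight K i j ≡ weight K j i
weight-sym K i j = cong₂ (λ b m → if b then two/ m else 0ℚ) (Graph.sym K i j) (ℕP.+-comm (deg K i) (deg K j))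

H≡∑<weight : ∀ (K : Graph n) → H K ≡ ∑< (weight K)
H≡∑<weight {n} K = begin
  H K                                           ≡⟨ sumOver-concatMap t neighboursAbove (allFin n) ⟩
  sumOver (sumOver t ∘ neighboursAbove) (allFin n) ≡⟨ sumOver-tabulate (sumOver t ∘ neighboursAbove) (λ i → i) ⟩
  sum (sumOver t ∘ neighboursAbove)            ≡⟨ sum-cong-≗ row-sum ⟩
  ∑< (weight K)                                 ∎
  where
  open ≡-Reasoning
  t : Fin n × Fin n → ℚ
  t e = two/ (deg K (proj₁ e) ℕ.+ deg K (proj₂ e))
  adjacent? = λ i j → adj K i j BoolP.≟ true
  above? = λ i j → toℕ i <? toℕ j
  adjacentTo adjacentAbove : Fin n → List (Fin n)
  adjacentTo i = filter (adjacent? i) (allFin n)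
  adjacentAbove i = filter (above? i) (adjacentTo i)
  neighboursAbove : Fin n → List (Fin n × Fin n)
  neighboursAbove i = map (i ,_) (adjacentAbove i)
  termAbove : Fin n → Fin n → ℚ
  termAbove i j = if toℕ i <ᵇ toℕ j then t (i , j) else 0ℚ
  term : Fin n → Fin n → ℚ
  term i j = if does (adjacent? i j) then termAbove i j else 0ℚ
  reorder : ∀ i j → term i j ≡ upper (weight K) i j
  reorder i j with adj K i j | toℕ i <ᵇ toℕ j
  ... | true  | _     = refl
  ... | false | true  = refl
  ... | false | false = refl
  row-sum : ∀ i → sumOver t (neighboursAbove i) ≡ sum (upper (weight K) i)
  row-sum i = begin
    sumOver t (neighboursAbove i)               ≡⟨ sumOver-map t (i ,_) (adjacentAbove i) ⟩
    sumOver (λ j → t (i , j)) (adjacentAbove i) ≡⟨ sumOver-filter (above? i) (λ j → t (i , j)) (adjacentTo i) ⟩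
    sumOver (termAbove i) (adjacentTo i)        ≡⟨ sumOver-filter (adjacent? i) (termAbove i) (allFin n) ⟩
    sumOver (term i) (allFin n)                 ≡⟨ sumOver-tabulate (term i) (λ j → j) ⟩
    sum (term i)                                ≡⟨ sum-cong-≗ (reorder i) ⟩
    sum (upper (weight K) i)                    ∎

-- Deleting an edge

deg-≗ : ∀ {K K′ : Graph n} {i} → (∀ j → adj K′ i j ≡ adj K i j) → deg K′ i ≡ deg K i
deg-≗ {K = K} {K′} {i} same = begin
  deg K′ i          ≡⟨ deg-count K′ i ⟩
  count (adj K′ i)  ≡⟨ Σℕ.sum-cong-≗ (cong indicator ∘ same) ⟩
  count (adj K i)   ≡⟨ deg-count K i ⟨
  deg K i           ∎
  where open ≡-Reasoning

deg-remove : ∀ {K K′ : Graph n} {i j} → (∀ k → adj K′ i k ≡ remove j (adj K i) k) →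
             adj K i j ≡ true → deg K i ≡ suc (deg K′ i)
deg-remove {K = K} {K′} {i} {j} row ij = begin
  deg K i                           ≡⟨ deg-count K i ⟩
  count (adj K i)                   ≡⟨ count-remove (adj K i) j ij ⟩
  suc (count (remove j (adj K i)))  ≡⟨ cong suc (Σℕ.sum-cong-≗ (cong indicator ∘ row)) ⟨
  suc (count (adj K′ i))            ≡⟨ cong suc (deg-count K′ i) ⟨
  suc (deg K′ i)                    ∎
  where open ≡-Reasoning

1≤deg : ∀ (K : Graph n) {i j} → adj K i j ≡ true → 1 ℕ.≤ deg K i
1≤deg K {i} {j} ij rewrite deg-count K i | count-remove (adj K i) j ij = s≤s z≤n

2≤deg : ∀ (K : Graph n) {i j k} → adj K i j ≡ true → adj K i k ≡ true → j ≢ k → 2 ℕ.≤ deg K i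
2≤deg K {i} {j} {k} ij ik j≢k
  rewrite deg-count K i | count-remove (adj K i) j ij
        | count-remove (remove j (adj K i)) k (trans (remove-other (adj K i) (j≢k ∘ sym)) ik) = s≤s (s≤s z≤n)

module _ (G : Graph n) {u v : Fin n} (u≢v : u ≢ v) where

  private
    G′ = deleteEdge G u v

  deleteEdge-row₁ : ∀ j → adj G′ u j ≡ remove v (adj G u) j
  deleteEdge-row₁ j rewrite ⌊≟⌋-refl u | ⌊≟⌋-≢ u≢v = cong (λ b → adj G u j ∧ not b) (∨-identityʳ _)

  deleteEdge-row₂ : ∀ j → adj G′ v j ≡ remove u (adj G v) j
  deleteEdge-row₂ j rewrite ⌊≟⌋-refl v | ⌊≟⌋-≢ (u≢v ∘ sym) = refl

  deleteEdge-away : ∀ {i} → i ≢ u → i ≢ v → ∀ j → adj G′ i j ≡ adj G i j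
  deleteEdge-away i≢u i≢v j rewrite ⌊≟⌋-≢ i≢u | ⌊≟⌋-≢ i≢v = ∧-identityʳ _

otherNeighbours : Graph n → (p q w : Fin n) → Fin n → Bool
otherNeighbours G p q w = remove w (remove q (adj G p))

-- A bound for the increase of the weight of an edge pj ≠ pq when deg p drops by one
-- (two/-step): δ (deg p) for any neighbour j, which has degree ≥ 1, and the smaller
-- δ (deg p + 1) for the neighbour w, which has degree ≥ 2.
correctionWith : Graph n → Fin n → Bool → Bool → ℚ
correctionWith G p other isW = (if other then δ (deg G p) else 0ℚ) ℚ.+ (if isW then δ (suc (deg G p)) else 0ℚ)

correction : Graph n → (p q w : Fin n) → Fin n → ℚ
correction G p q w j = correctionWith G p (otherNeighbours G p q w j) ⌊ j ≟ w ⌋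

if-nonneg : ∀ b {x} → 0ℚ ℚ.≤ x → 0ℚ ℚ.≤ (if b then x else 0ℚ)
if-nonneg true  0≤x = 0≤x
if-nonneg false _   = ℚP.≤-refl

correction-nonneg : ∀ (G : Graph n) p q w j → 0ℚ ℚ.≤ correction G p q w j
correction-nonneg G p q w j = ℚP.+-mono-≤ (if-nonneg (otherNeighbours G p q w j) (δ-nonneg (deg G p)))
                                          (if-nonneg ⌊ j ≟ w ⌋ (δ-nonneg (suc (deg G p))))

correction-at-w : ∀ (G : Graph n) p q w → correction G p q w w ≡ δ (suc (deg G p))
correction-at-w G p q w = trans (cong₂ (correctionWith G p) (remove-self w (remove q (adj G p))) (⌊≟⌋-refl w))
                                (ℚP.+-identityˡ (δ (suc (deg G p))))

correction-at-other : ∀ (G : Graph n) {p q w j} → adj G p j ≡ true → j ≢ q → j ≢ w →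
                      correction G p q w j ≡ δ (deg G p)
correction-at-other G {p} {q} {w} {j} pj j≢q j≢w =
  trans (cong₂ (correctionWith G p) other (⌊≟⌋-≢ j≢w)) (ℚP.+-identityʳ (δ (deg G p)))
  where
  other : otherNeighbours G p q w j ≡ true
  other = trans (remove-other (remove q (adj G p)) j≢w) (trans (remove-other (adj G p) j≢q) pj)

weight-endpoint : ∀ {G G′ : Graph n} {p q w j} → (∀ k → adj G′ p k ≡ remove q (adj G p) k) →
                  adj G p q ≡ true → 2 ℕ.≤ deg G w → j ≢ q → deg G′ j ≡ deg G j →
                  weight G′ p j ℚ.≤ weight G p j ℚ.+ correction G p q w j
weight-endpoint {G = G} {G′} {p} {q} {w} {j} row pq 2≤dw j≢q dj = begin
  weight G′ p j                                        ≡⟨ cong₂ (λ b x → if b then two/ (a ℕ.+ x) else 0ℚ)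
                                                              (trans (row j) (remove-other (adj G p) j≢q)) dj ⟩
  (if adj G p j then two/ (a ℕ.+ x) else 0ℚ)           ≤⟨ bound (adj G p j) refl ⟩
  (if adj G p j then two/ (suc a ℕ.+ x) else 0ℚ) ℚ.+ c ≡⟨ cong (λ d → (if adj G p j then two/ (d ℕ.+ x) else 0ℚ) ℚ.+ c) dp ⟨
  weight G p j ℚ.+ c                                   ∎
  where
  open ℚP.≤-Reasoning
  a = deg G′ p
  x = deg G j
  c = correction G p q w j
  dp : deg G p ≡ suc a
  dp = deg-remove {K = G} {G′} row pq
  bound : ∀ b → adj G p j ≡ b → (if b then two/ (a ℕ.+ x) else 0ℚ) ℚ.≤ (if b then two/ (suc a ℕ.+ x) else 0ℚ) ℚ.+ c
  bound false _  = subst (ℚ._≤ 0ℚ ℚ.+ c) (ℚP.+-identityˡ 0ℚ) (ℚP.+-monoʳ-≤ 0ℚ (correction-nonneg G p q w j))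
  bound true  pj = byNeighbour (j ≟ w)
    where
    byNeighbour : Dec (j ≡ w) → two/ (a ℕ.+ x) ℚ.≤ two/ (suc a ℕ.+ x) ℚ.+ c
    byNeighbour (yes refl) = begin
      two/ (a ℕ.+ x)                            ≤⟨ two/-step a x 1 2≤dw ⟩
      two/ (suc a ℕ.+ x) ℚ.+ δ (suc (suc a))    ≡⟨ cong (λ d → two/ (suc a ℕ.+ x) ℚ.+ δ (suc d)) dp ⟨
      two/ (suc a ℕ.+ x) ℚ.+ δ (suc (deg G p))  ≡⟨ cong (two/ (suc a ℕ.+ x) ℚ.+_) (correction-at-w G p q j) ⟨
      two/ (suc a ℕ.+ x) ℚ.+ c                  ∎
    byNeighbour (no j≢w) = begin
      two/ (a ℕ.+ x)                            ≤⟨ two/-step a x 0 (1≤deg G (trans (Graph.sym G j p) pj)) ⟩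
      two/ (suc a ℕ.+ x) ℚ.+ δ (suc a)          ≡⟨ cong (λ d → two/ (suc a ℕ.+ x) ℚ.+ δ d) dp ⟨
      two/ (suc a ℕ.+ x) ℚ.+ δ (deg G p)        ≡⟨ cong (two/ (suc a ℕ.+ x) ℚ.+_) (correction-at-other G pj j≢q j≢w) ⟨
      two/ (suc a ℕ.+ x) ℚ.+ c                  ∎

deg-others : ∀ (G : Graph n) {p q w} → adj G p q ≡ true → adj G p w ≡ true → w ≢ q →
             deg G p ≡ 2 ℕ.+ count (otherNeighbours G p q w)
deg-others G {p} {q} {w} pq pw w≢q = begin
  deg G p                                              ≡⟨ deg-count G p ⟩
  count (adj G p)                                      ≡⟨ count-remove (adj G p) q pq ⟩
  suc (count (remove q (adj G p)))                     ≡⟨ cong suc (count-remove (remove q (adj G p)) w qw) ⟩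
  2 ℕ.+ count (otherNeighbours G p q w)                ∎
  where
  open ≡-Reasoning
  qw : remove q (adj G p) w ≡ true
  qw = trans (remove-other (adj G p) w≢q) pw

sum-correction : ∀ (G : Graph n) {p q w} → adj G p q ≡ true → adj G p w ≡ true → w ≢ q →
                 sum (correction G p q w) ≡ Φ (count (otherNeighbours G p q w))
sum-correction G {p} {q} {w} pq pw w≢q = begin
  sum (correction G p q w)                        ≡⟨ ∑-distrib-+ (λ j → if others j then δ d else 0ℚ) isW ⟩
  sum (λ j → if others j then δ d else 0ℚ) ℚ.+ sum isW ≡⟨ cong₂ ℚ._+_ (sum-indicator others (δ d)) (sum-single isW w isW-off) ⟩
  k · δ d ℚ.+ isW w                                ≡⟨ cong (k · δ d ℚ.+_) (cong (λ b → if b then δ (suc d) else 0ℚ) (⌊≟⌋-refl w)) ⟩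
  k · δ d ℚ.+ δ (suc d)                            ≡⟨ cong (λ d → k · δ d ℚ.+ δ (suc d)) (deg-others G pq pw w≢q) ⟩
  Φ k                                              ∎
  where
  open ≡-Reasoning
  others = otherNeighbours G p q w
  k = count others
  d = deg G p
  isW : Fin _ → ℚ
  isW j = if ⌊ j ≟ w ⌋ then δ (suc d) else 0ℚ
  isW-off : ∀ j → j ≢ w → isW j ≡ 0ℚ
  isW-off j j≢w = cong (λ b → if b then δ (suc d) else 0ℚ) (⌊≟⌋-≢ j≢w)

correction-self : ∀ (G : Graph n) p q w → w ≢ p → correction G p q w p ≡ 0ℚ
correction-self G p q w w≢p = cong₂ (correctionWith G p) (cong (λ b → (b ∧ not ⌊ p ≟ q ⌋) ∧ not ⌊ p ≟ w ⌋) (irrefl G p))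
                                                         (⌊≟⌋-≢ (w≢p ∘ sym))

-- Comparing H G and H (G − uv) pair by pair

symm : ∀ {n} → (Fin n → Fin n → ℚ) → Fin n → Fin n → ℚ
symm R i j = R i j ℚ.+ R j i

module _ {n} (G : Graph n) {u v w z : Fin n}
         (uv : adj G u v ≡ true) (uw : adj G u w ≡ true) (w≢u : w ≢ u) (w≢v : w ≢ v) (2≤dw : 2 ℕ.≤ deg G w)
         (vz : adj G v z ≡ true) (z≢u : z ≢ u) (z≢v : z ≢ v) (2≤dz : 2 ℕ.≤ deg G z) where

  private
    G′ = deleteEdge G u v

    u≢v : u ≢ v
    u≢v refl with trans (sym uv) (irrefl G u)
    ... | ()

    vu : adj G v u ≡ true
    vu = trans (Graph.sym G v u) uv

    c : ℚ
    c = weight G u v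

    at-v : Fin n → ℚ
    at-v j = if ⌊ j ≟ v ⌋ then c else 0ℚ

    ρu ρv : Fin n → ℚ
    ρu = correction G u v w
    ρv = correction G v u z

    lost gained : Fin n → Fin n → ℚ
    lost = row u at-v
    gained i j = row u ρu i j ℚ.+ row v ρv i j

    deg-away : ∀ {j} → j ≢ u → j ≢ v → deg G′ j ≡ deg G j
    deg-away j≢u j≢v = deg-≗ {K = G} {G′} (deleteEdge-away G u≢v j≢u j≢v)

    lost-off : ∀ i j → i ≢ u ⊎ j ≢ v → lost i j ≡ 0ℚ
    lost-off i j (inj₁ i≢u) = row-other at-v i≢u j
    lost-off i j (inj₂ j≢v) with ⌊ i ≟ u ⌋
    ... | true  = cong (λ b → if b then c else 0ℚ) (⌊≟⌋-≢ j≢v)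
    ... | false = refl

    gained-u : ∀ j → gained u j ≡ ρu j
    gained-u j = trans (cong₂ ℚ._+_ (row-self u ρu j) (row-other ρv u≢v j)) (ℚP.+-identityʳ (ρu j))

    gained-v : ∀ j → gained v j ≡ ρv j
    gained-v j = trans (cong₂ ℚ._+_ (row-other ρu (u≢v ∘ sym) j) (row-self v ρv j)) (ℚP.+-identityˡ (ρv j))

    gained-nonneg : ∀ i j → 0ℚ ℚ.≤ gained i j
    gained-nonneg i j = ℚP.+-mono-≤ (row-nonneg u ρu (correction-nonneg G u v w) i j) (row-nonneg v ρv (correction-nonneg G v u z) i j)

    Pointwise : Fin n → Fin n → Set
    Pointwise i j = weight G′ i j ℚ.+ symm lost i j ℚ.≤ weight G i j ℚ.+ symm gained i j

    pointwise-swap : ∀ {i j} → Pointwise i j → Pointwise j i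
    pointwise-swap {i} {j} = subst₂ ℚ._≤_ (cong₂ ℚ._+_ (weight-sym G′ i j) (ℚP.+-comm (lost i j) (lost j i)))
                                          (cong₂ ℚ._+_ (weight-sym G i j) (ℚP.+-comm (gained i j) (gained j i)))

    pointwise-endpoint : ∀ p j → symm lost p j ≡ 0ℚ → weight G′ p j ℚ.≤ weight G p j ℚ.+ gained p j → Pointwise p j
    pointwise-endpoint p j no-loss bound = begin
      weight G′ p j ℚ.+ symm lost p j       ≡⟨ trans (cong (weight G′ p j ℚ.+_) no-loss) (ℚP.+-identityʳ (weight G′ p j)) ⟩
      weight G′ p j                         ≤⟨ bound ⟩
      weight G p j ℚ.+ gained p j           ≤⟨ ℚP.+-monoʳ-≤ (weight G p j) (p≤p+q (gained-nonneg j p)) ⟩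
      weight G p j ℚ.+ symm gained p j      ∎
      where open ℚP.≤-Reasoning

    pointwise-edge : Pointwise u v
    pointwise-edge = begin
      weight G′ u v ℚ.+ symm lost u v       ≡⟨ cong₂ ℚ._+_ weight′-uv (cong₂ ℚ._+_ lost-uv (lost-off v u (inj₁ (u≢v ∘ sym)))) ⟩
      0ℚ ℚ.+ (c ℚ.+ 0ℚ)                     ≡⟨ trans (ℚP.+-identityˡ (c ℚ.+ 0ℚ)) (ℚP.+-identityʳ c) ⟩
      c                                     ≤⟨ p≤p+q (ℚP.+-mono-≤ (gained-nonneg u v) (gained-nonneg v u)) ⟩
      weight G u v ℚ.+ symm gained u v      ∎
      where
      open ℚP.≤-Reasoning
      weight′-uv : weight G′ u v ≡ 0ℚ
      weight′-uv = cong (λ b → if b then two/ (deg G′ u ℕ.+ deg G′ v) else 0ℚ)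
                        (trans (deleteEdge-row₁ G u≢v v) (remove-self v (adj G u)))
      lost-uv : lost u v ≡ c
      lost-uv = trans (row-self u at-v v) (cong (λ b → if b then c else 0ℚ) (⌊≟⌋-refl v))

    pointwise-u : ∀ {j} → j ≢ u → Pointwise u j
    pointwise-u {j} j≢u = byCases (j ≟ v)
      where
      byCases : Dec (j ≡ v) → Pointwise u j
      byCases (yes refl) = pointwise-edge
      byCases (no  j≢v)  = pointwise-endpoint u j (cong₂ ℚ._+_ (lost-off u j (inj₂ j≢v)) (lost-off j u (inj₁ j≢u)))
        (subst (λ r → weight G′ u j ℚ.≤ weight G u j ℚ.+ r) (sym (gained-u j))
          (weight-endpoint {G = G} {G′} (deleteEdge-row₁ G u≢v) uv 2≤dw j≢v (deg-away j≢u j≢v)))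

    pointwise-v : ∀ {j} → j ≢ v → Pointwise v j
    pointwise-v {j} j≢v = byCases (j ≟ u)
      where
      byCases : Dec (j ≡ u) → Pointwise v j
      byCases (yes refl) = pointwise-swap (pointwise-u (u≢v ∘ sym))
      byCases (no  j≢u)  = pointwise-endpoint v j (cong₂ ℚ._+_ (lost-off v j (inj₁ (u≢v ∘ sym))) (lost-off j v (inj₁ j≢u)))
        (subst (λ r → weight G′ v j ℚ.≤ weight G v j ℚ.+ r) (sym (gained-v j))
          (weight-endpoint {G = G} {G′} (deleteEdge-row₂ G u≢v) vu 2≤dz j≢u (deg-away j≢u j≢v)))

    pointwise-away : ∀ {i j} → i ≢ u → i ≢ v → j ≢ u → j ≢ v → Pointwise i j
    pointwise-away {i} {j} i≢u i≢v j≢u j≢v = begin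
      weight G′ i j ℚ.+ symm lost i j   ≡⟨ cong₂ ℚ._+_ weight-same (cong₂ ℚ._+_ (lost-off i j (inj₁ i≢u)) (lost-off j i (inj₁ j≢u))) ⟩
      weight G i j ℚ.+ 0ℚ               ≤⟨ ℚP.+-monoʳ-≤ (weight G i j) (ℚP.+-mono-≤ (gained-nonneg i j) (gained-nonneg j i)) ⟩
      weight G i j ℚ.+ symm gained i j  ∎
      where
      open ℚP.≤-Reasoning
      weight-same : weight G′ i j ≡ weight G i j
      weight-same = cong₂ (λ b d → if b then two/ d else 0ℚ) (deleteEdge-away G u≢v i≢u i≢v j)
                          (cong₂ ℕ._+_ (deg-away i≢u i≢v) (deg-away j≢u j≢v))

    pointwise : ∀ i j → i ≢ j → Pointwise i j
    pointwise i j i≢j = byCases (i ≟ u) (i ≟ v) (j ≟ u) (j ≟ v)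
      where
      byCases : Dec (i ≡ u) → Dec (i ≡ v) → Dec (j ≡ u) → Dec (j ≡ v) → Pointwise i j
      byCases (yes refl) _          _          _          = pointwise-u (i≢j ∘ sym)
      byCases (no  _)    (yes refl) _          _          = pointwise-v (i≢j ∘ sym)
      byCases (no  i≢u)  (no  _)    (yes refl) _          = pointwise-swap (pointwise-u i≢u)
      byCases (no  _)    (no  i≢v)  (no  _)    (yes refl) = pointwise-swap (pointwise-v i≢v)
      byCases (no  i≢u)  (no  i≢v)  (no  j≢u)  (no  j≢v)  = pointwise-away i≢u i≢v j≢u j≢v

    lost-diag : ∀ i → lost i i ≡ 0ℚ
    lost-diag i = lost-off i i (byCases (i ≟ u))
      where
      byCases : Dec (i ≡ u) → i ≢ u ⊎ i ≢ v
      byCases (yes refl) = inj₂ u≢v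
      byCases (no  i≢u)  = inj₁ i≢u

    gained-diag : ∀ i → gained i i ≡ 0ℚ
    gained-diag i = cong₂ ℚ._+_ (row-diag u ρu (correction-self G u v w w≢u) i) (row-diag v ρv (correction-self G v u z z≢v) i)

    ∑∑-lost : ∑∑ lost ≡ c
    ∑∑-lost = begin
      ∑∑ lost   ≡⟨ ∑∑-row u at-v ⟩
      sum at-v  ≡⟨ sum-single at-v v (λ j j≢v → cong (λ b → if b then c else 0ℚ) (⌊≟⌋-≢ j≢v)) ⟩
      at-v v    ≡⟨ cong (λ b → if b then c else 0ℚ) (⌊≟⌋-refl v) ⟩
      c         ∎
      where open ≡-Reasoning

    ∑∑-gained : ∑∑ gained ≡ sum ρu ℚ.+ sum ρv
    ∑∑-gained = trans (∑∑-+ (row u ρu) (row v ρv)) (cong₂ ℚ._+_ (∑∑-row u ρu) (∑∑-row v ρv))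

    H-deleteEdge : H G′ ℚ.+ c ℚ.≤ H G ℚ.+ (sum ρu ℚ.+ sum ρv)
    H-deleteEdge = begin
      H G′ ℚ.+ c                                         ≡⟨ cong₂ ℚ._+_ (H≡∑<weight G′) (sym (trans (∑<-symmetrise lost lost-diag) ∑∑-lost)) ⟩
      ∑< (weight G′) ℚ.+ ∑< (symm lost)                  ≡⟨ ∑<-+ (weight G′) (symm lost) ⟨
      ∑< (λ i j → weight G′ i j ℚ.+ symm lost i j)       ≤⟨ ∑<-mono-≤ pointwise ⟩
      ∑< (λ i j → weight G i j ℚ.+ symm gained i j)      ≡⟨ ∑<-+ (weight G) (symm gained) ⟩
      ∑< (weight G) ℚ.+ ∑< (symm gained)                 ≡⟨ cong₂ ℚ._+_ (sym (H≡∑<weight G)) (trans (∑<-symmetrise gained gained-diag) ∑∑-gained) ⟩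
      H G ℚ.+ (sum ρu ℚ.+ sum ρv)                        ∎
      where open ℚP.≤-Reasoning

  H-deleteEdge-bound : H G′ ℚ.- + 31 / 105 ℚ.≤ H G
  H-deleteEdge-bound = p+r≤q+[s+r]⇒p-s≤q {H G′} {H G} {c} {+ 31 / 105} (begin
    H G′ ℚ.+ c                                ≤⟨ H-deleteEdge ⟩
    H G ℚ.+ (sum ρu ℚ.+ sum ρv)               ≡⟨ cong (H G ℚ.+_) (cong₂ ℚ._+_ (sum-correction G uv uw w≢v) (sum-correction G vu vz z≢u)) ⟩
    H G ℚ.+ (Φ ku ℚ.+ Φ kv)                   ≤⟨ ℚP.+-monoʳ-≤ (H G) (Φ-pair ku kv) ⟩
    H G ℚ.+ (+ 31 / 105 ℚ.+ two/ ((2 ℕ.+ ku) ℕ.+ (2 ℕ.+ kv))) ≡⟨ cong (λ x → H G ℚ.+ (+ 31 / 105 ℚ.+ x)) c≡ ⟨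
    H G ℚ.+ (+ 31 / 105 ℚ.+ c)                ∎)
    where
    open ℚP.≤-Reasoning
    ku = count (otherNeighbours G u v w)
    kv = count (otherNeighbours G v u z)
    c≡ : c ≡ two/ ((2 ℕ.+ ku) ℕ.+ (2 ℕ.+ kv))
    c≡ = trans (cong (λ b → if b then two/ (deg G u ℕ.+ deg G v) else 0ℚ) uv)
               (cong₂ (λ x y → two/ (x ℕ.+ y)) (deg-others G uv uw w≢v) (deg-others G vu vz z≢u))

-- The neighbours of the endpoints on the cycle

module _ {n} (G : Graph n) where

  private
    walk-last : ∀ {s t ws} → Walk G s t ws → t ∈ ws
    walk-last here       = here refl
    walk-last (step _ r) = there (walk-last r)

    walk-first : ∀ {s t ws} → Walk G s t ws → s ∈ ws
    walk-first here       = here refl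
    walk-first (step _ _) = here refl

    walk-nonempty : ∀ {s t ws} → Walk G s t ws → 1 ℕ.≤ length ws
    walk-nonempty here       = s≤s z≤n
    walk-nonempty (step _ _) = s≤s z≤n

    ∉⇒≢ : ∀ {x y : Fin n} {ws} → All (x ≢_) ws → y ∈ ws → y ≢ x
    ∉⇒≢ x∉ y∈ = All.lookup x∉ y∈ ∘ sym

  second-vertex : ∀ {s t ws} → Walk G s t ws → Unique ws → 3 ℕ.≤ length ws →
                  ∃[ w ] adj G s w ≡ true × w ≢ s × w ≢ t × 2 ℕ.≤ deg G w
  second-vertex here                _ (s≤s ())
  second-vertex (step _ here)       _ (s≤s (s≤s ()))
  second-vertex (step sw (step wx r)) (s∉ ∷ w∉ ∷ _) _ =
    _ , sw , ∉⇒≢ s∉ (here refl) , (∉⇒≢ w∉ (walk-last r) ∘ sym) ,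
    2≤deg G (trans (Graph.sym G _ _) sw) wx (∉⇒≢ s∉ (there (walk-first r)) ∘ sym)

  penultimate-vertex : ∀ {s t ws} → Walk G s t ws → Unique ws → 3 ℕ.≤ length ws →
                       ∃[ z ] adj G t z ≡ true × z ≢ s × z ≢ t × 2 ℕ.≤ deg G z × z ∈ ws
  penultimate-vertex here                _ (s≤s ())
  penultimate-vertex (step _ here)       _ (s≤s (s≤s ()))
  penultimate-vertex (step sz (step zt here)) (s∉ ∷ z∉ ∷ _) _ =
    _ , trans (Graph.sym G _ _) zt , ∉⇒≢ s∉ (here refl) , (∉⇒≢ z∉ (here refl) ∘ sym) ,
    2≤deg G (trans (Graph.sym G _ _) sz) zt (∉⇒≢ s∉ (there (here refl)) ∘ sym) , there (here refl)
  penultimate-vertex (step _ r@(step _ (step _ r′))) (s∉ ∷ r-unique) _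
    with penultimate-vertex r r-unique (s≤s (s≤s (walk-nonempty r′)))
  ... | z , tz , _ , z≢t , 2≤dz , z∈ = z , tz , ∉⇒≢ s∉ z∈ , z≢t , 2≤dz , there z∈

lemma3 : ∀ {n : ℕ} (G : Graph n) (u v : Fin n) → Connected G → CyclomaticAtLeast1 G → OnCycle G u v →
         H (deleteEdge G u v) ℚ.- (+ 31 / 105) ℚ.≤ H G
lemma3 G u v _ _ (uv , _ , path , unique , 3≤length)
  with second-vertex G path unique 3≤length | penultimate-vertex G path unique 3≤length
... | w , uw , w≢u , w≢v , 2≤dw | z , vz , z≢u , z≢v , 2≤dz , _ =
  H-deleteEdge-bound G uv uw w≢u w≢v 2≤dw vz z≢u z≢v 2≤dz
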